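{- Let $w\in S_n$ be a permutation avoiding the pattern $312$, and let $u\in S_n$ be a permutation avoiding the pattern $132$. If $L(w)$ is a rearrangement of $L(u)$ and $R(w)$ is a rearrangement of $R(u)$, then $w=u$.
   Context: For $w=w_1\cdots w_n\in S_n$ and $1\le i\le n$, let $l_i(w)=|\{j: j<i,\ w_j<w_i\}|$ and $r_i(w)=|\{j: j<i,\ w_j>w_i\}|$, and set $L(w)=(l_1(w),\ldots,l_n(w))$, $R(w)=(r_1(w),\ldots,r_n(w))$. A vector $v=(v_1,\ldots,v_n)$ is a rearrangement of $v'=(v'_1,\ldots,v'_n)$ if $v=(v'_{\pi_1},\ldots,v'_{\pi_n})$ for some $\pi\in S_n$. $w$ avoids $132$ if there are no $i<j<k$ with $w_i<w_k<w_j$; $w$ avoids $312$ if there are no $i<j<k$ with $w_j<w_k<w_i$. -}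

module Defs where

open import Data.Nat using (ℕ)
open import Data.Empty using (⊥)
open import Data.Fin using (Fin; _<_)
open import Data.Fin.Properties using (_<?_)
open import Data.Fin.Permutation using (Permutation′; _⟨$⟩ʳ_)
open import Data.List using (List; length; filter; allFin)
open import Data.Product using (_×_; ∃; _,_)
open import Relation.Nullary.Decidable using (_×-dec_)
open import Relation.Binary.PropositionalEquality using (_≡_)

-- A permutation w ∈ S_n, with entries w_i = w ⟨$⟩ʳ i (positions and values in Fin n,
-- i.e. 0-based; order-based notions are unaffected by the shift).
Perm : ℕ → Set
Perm n = Permutation′ n

l : ∀ {n} → Perm n → Fin n → ℕ
l w i = length (filter (λ j → (j <? i) ×-dec ((w ⟨$⟩ʳ j) <? (w ⟨$⟩ʳ i))) (allFin _))

r : ∀ {n} → Perm n → Fin n → ℕ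
r w i = length (filter (λ j → (j <? i) ×-dec ((w ⟨$⟩ʳ i) <? (w ⟨$⟩ʳ j))) (allFin _))

L : ∀ {n} → Perm n → Fin n → ℕ
L = l

R : ∀ {n} → Perm n → Fin n → ℕ
R = r

IsRearrangementOf : ∀ {n} → (Fin n → ℕ) → (Fin n → ℕ) → Set
IsRearrangementOf {n} v v' = ∃ λ (π : Perm n) → ∀ i → v i ≡ v' (π ⟨$⟩ʳ i)

Avoids132 : ∀ {n} → Perm n → Set
Avoids132 w = ∀ i j k → i < j → j < k →
  (w ⟨$⟩ʳ i) < (w ⟨$⟩ʳ k) → (w ⟨$⟩ʳ k) < (w ⟨$⟩ʳ j) → ⊥

Avoids312 : ∀ {n} → Perm n → Set
Avoids312 w = ∀ i j k → i < j → j < k →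
  (w ⟨$⟩ʳ j) < (w ⟨$⟩ʳ k) → (w ⟨$⟩ʳ k) < (w ⟨$⟩ʳ i) → ⊥

module Submission where

-- For a 312-avoiding w, the earlier entries smaller than w_p occupy the first l_p(w)
-- positions, so l_k(w) ≥ l_p(w) whenever l_p(w) ≤ k ≤ p; for the 132-avoiding u the same
-- holds for r. Let p be the last position and suppose l_p(w) ≤ r_p(u) (the other case is
-- symmetric). At k = r_p(u) we have l_k(w) ≥ l_p(w), and since every position in
-- r_p(u), …, p carries an R(u)-value ≥ r_p(u) while r_k ≤ k, the equal multisets of R give
-- r_k(w) ≥ r_p(u); with l_k + r_k = k this forces l_p(w) = 0, hence r_p(w) = p, hence
-- r_p(u) = p and l_p(u) = 0. So p is a left-to-right minimum of both permutations or a
-- left-to-right maximum of both; removing p keeps the multisets equal, and by induction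
-- w and u order every pair of positions alike, so they coincide.

open import Defs
open import Level using (0ℓ)
open import Data.Nat as ℕ using (ℕ; zero; suc; _+_; _≤_; z≤n; s≤s; s≤s⁻¹)
open import Data.Nat.Properties
  using (+-0-commutativeMonoid; ≤-refl; ≤-trans; ≤-reflexive; ≤-antisym; ≤-total;
         <⇒≤; <⇒≱; ≤-<-trans; <-≤-trans; m≤n⇒m<n∨m≡n; m<1+n⇒m<n∨m≡n; m<n⇒m<1+n; m≤n+m;
         +-mono-≤; +-monoˡ-≤; +-monoʳ-≤; +-comm; +-identityʳ; +-cancelʳ-≡; +-cancelˡ-≤;
         +-cancelʳ-≤; n≤0⇒n≡0; m+n≡0⇒m≡0; m+n≡0⇒n≡0; 1+n≢0; module ≤-Reasoning)
import Data.Fin as Fin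
open import Data.Fin using (Fin; toℕ; fromℕ<; _<_)
open import Data.Fin.Properties
  using (toℕ-injective; toℕ<n; 0≢1+n; toℕ-fromℕ<; suc-injective; <-cmp; <-trans; <-asym; <⇒≢; _<?_)
open import Data.Fin.Permutation using (_⟨$⟩ʳ_; _⟨$⟩ˡ_; inverseˡ)
open import Data.List using (length; filter; tabulate; allFin)
open import Data.Product using (_×_; _,_; proj₁; proj₂; swap)
open import Data.Sum as Sum using (_⊎_; inj₁; inj₂; [_,_])
open import Data.Empty using (⊥; ⊥-elim)
open import Function using (_∘_; flip)
open import Relation.Binary
  using (Rel; Trichotomous; Transitive; tri<; tri≈; tri>) renaming (Decidable to Decidable₂)
open import Relation.Binary.Consequences using (tri⇒asym)
open import Relation.Binary.PropositionalEquality
  using (_≡_; refl; sym; trans; cong; cong₂; subst; module ≡-Reasoning)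
open import Relation.Nullary using (Dec; yes; no; ¬_; contradiction)
open import Relation.Nullary.Decidable using (_×-dec_)
open import Relation.Unary using (Pred; Decidable; _⊆_; _∪_; ｛_｝)
open import Algebra.Properties.CommutativeMonoid.Sum +-0-commutativeMonoid
  using (sum; ∑-distrib-+; ∑-permute; sum-cong-≗)

private variable
  n : ℕ
  A B C : Set

χ : Dec A → ℕ
χ (yes _) = 1
χ (no _)  = 0

χ-yes : A → (a : Dec A) → χ a ≡ 1
χ-yes x (yes _) = refl
χ-yes x (no ¬x) = contradiction x ¬x

χ-no : ¬ A → (a : Dec A) → χ a ≡ 0
χ-no ¬x (yes x) = contradiction x ¬x
χ-no ¬x (no _)  = refl

χ≡1⇒ : (a : Dec A) → χ a ≡ 1 → A
χ≡1⇒ (yes x) _ = x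

χ-mono : (A → B) → (a : Dec A) (b : Dec B) → χ a ≤ χ b
χ-mono f (yes x) b = ≤-reflexive (sym (χ-yes (f x) b))
χ-mono f (no _)  b = z≤n

χ-cong : (A → B) → (B → A) → (a : Dec A) (b : Dec B) → χ a ≡ χ b
χ-cong f g a b = ≤-antisym (χ-mono f a b) (χ-mono g b a)

χ-split : (A → B ⊎ C) → (B ⊎ C → A) → (B → ¬ C) →
          (a : Dec A) (b : Dec B) (c : Dec C) → χ a ≡ χ b + χ c
χ-split to from disjoint (yes x) (yes y) (yes z) = contradiction z (disjoint y)
χ-split to from disjoint (yes x) (yes y) (no _)  = refl
χ-split to from disjoint (yes x) (no _)  (yes z) = refl
χ-split to from disjoint (yes x) (no ¬y) (no ¬z) = ⊥-elim ([ ¬y , ¬z ] (to x))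
χ-split to from disjoint (no ¬x) (yes y) _       = contradiction (from (inj₁ y)) ¬x
χ-split to from disjoint (no ¬x) (no _)  (yes z) = contradiction (from (inj₂ z)) ¬x
χ-split to from disjoint (no ¬x) (no _)  (no _)  = refl

+-squeeze : ∀ {a b c d} → a ≤ c → b ≤ d → c + d ≤ a + b → c ≤ a × d ≤ b
+-squeeze {a} {b} {c} {d} a≤c b≤d c+d≤a+b =
  +-cancelʳ-≤ d c a (≤-trans c+d≤a+b (+-monoʳ-≤ a b≤d)) ,
  +-cancelˡ-≤ c d b (≤-trans c+d≤a+b (+-monoˡ-≤ b a≤c))

sum-mono : (f g : Fin n → ℕ) → (∀ k → f k ≤ g k) → sum f ≤ sum g
sum-mono {zero}  f g f≤g = z≤n
sum-mono {suc n} f g f≤g =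
  +-mono-≤ (f≤g Fin.zero) (sum-mono (f ∘ Fin.suc) (g ∘ Fin.suc) (f≤g ∘ Fin.suc))

sum-squeeze : (f g : Fin n → ℕ) → (∀ k → f k ≤ g k) → sum g ≤ sum f → ∀ k → f k ≡ g k
sum-squeeze {suc n} f g f≤g ∑g≤∑f = λ where
    Fin.zero    → ≤-antisym (f≤g Fin.zero) (proj₁ squeezed)
    (Fin.suc k) → sum-squeeze (f ∘ Fin.suc) (g ∘ Fin.suc) (f≤g ∘ Fin.suc) (proj₂ squeezed) k
  where
  squeezed : g Fin.zero ≤ f Fin.zero × sum (g ∘ Fin.suc) ≤ sum (f ∘ Fin.suc)
  squeezed = +-squeeze (f≤g Fin.zero) (sum-mono (f ∘ Fin.suc) (g ∘ Fin.suc) (f≤g ∘ Fin.suc)) ∑g≤∑f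

count : {P : Pred (Fin n) 0ℓ} → Decidable P → ℕ
count P? = sum (λ k → χ (P? k))

module _ {P Q : Pred (Fin n) 0ℓ} (P? : Decidable P) (Q? : Decidable Q) where

  count-mono : P ⊆ Q → count P? ≤ count Q?
  count-mono P⊆Q = sum-mono _ _ (λ k → χ-mono P⊆Q (P? k) (Q? k))

  count-cong : P ⊆ Q → Q ⊆ P → count P? ≡ count Q?
  count-cong P⊆Q Q⊆P = sum-cong-≗ (λ k → χ-cong P⊆Q Q⊆P (P? k) (Q? k))

  count-squeeze : Q ⊆ P → count P? ≤ count Q? → P ⊆ Q
  count-squeeze Q⊆P #P≤#Q {k} Pk = χ≡1⇒ (Q? k) (trans (χQ≡χP k) (χ-yes Pk (P? k)))
    where
    χQ≡χP : ∀ k → χ (Q? k) ≡ χ (P? k)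
    χQ≡χP = sum-squeeze _ _ (λ k → χ-mono Q⊆P (Q? k) (P? k)) #P≤#Q

  count-⊎ : {R : Pred (Fin n) 0ℓ} (R? : Decidable R) → P ⊆ Q ∪ R → Q ∪ R ⊆ P →
            (∀ {k} → Q k → ¬ R k) → count P? ≡ count Q? + count R?
  count-⊎ R? to from disjoint =
    trans (sum-cong-≗ (λ k → χ-split to from disjoint (P? k) (Q? k) (R? k)))
          (∑-distrib-+ (λ k → χ (Q? k)) (λ k → χ (R? k)))

count-∅ : {P : Pred (Fin n) 0ℓ} (P? : Decidable P) → (∀ k → ¬ P k) → count P? ≡ 0
count-∅ {zero}  P? ∅ = refl
count-∅ {suc n} P? ∅ =
  cong₂ _+_ (χ-no (∅ Fin.zero) (P? Fin.zero)) (count-∅ (P? ∘ Fin.suc) (∅ ∘ Fin.suc))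

count-singleton : {P : Pred (Fin n) 0ℓ} (P? : Decidable P) {p : Fin n} → P ⊆ ｛ p ｝ →
                  count P? ≡ χ (P? p)
count-singleton {suc n} P? {Fin.zero} P⊆p =
  trans (cong (χ (P? Fin.zero) +_) (count-∅ (P? ∘ Fin.suc) (λ k → 0≢1+n ∘ P⊆p))) (+-identityʳ _)
count-singleton {suc n} P? {Fin.suc p} P⊆p =
  cong₂ _+_ (χ-no (0≢1+n ∘ sym ∘ P⊆p) (P? Fin.zero))
            (count-singleton (P? ∘ Fin.suc) (suc-injective ∘ P⊆p))

count≡0⇒∉ : {P : Pred (Fin n) 0ℓ} (P? : Decidable P) → count P? ≡ 0 → ∀ k → ¬ P k
count≡0⇒∉ {suc n} P? #P≡0 Fin.zero    P0 =
  1+n≢0 (trans (sym (χ-yes P0 (P? Fin.zero))) (m+n≡0⇒m≡0 _ #P≡0))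
count≡0⇒∉ {suc n} P? #P≡0 (Fin.suc k) Pk = count≡0⇒∉ (P? ∘ Fin.suc) (m+n≡0⇒n≡0 _ #P≡0) k Pk

count-below : ∀ {m} → m ≤ n → count (λ (k : Fin n) → toℕ k ℕ.<? m) ≡ m
count-below {zero}  {zero}  z≤n        = refl
count-below {suc n} {zero}  z≤n        = count-∅ (λ (k : Fin (suc n)) → toℕ k ℕ.<? 0) (λ k ())
count-below {suc n} {suc m} (s≤s m≤n) =
  cong suc (trans (count-cong (λ (k : Fin n) → suc (toℕ k) ℕ.<? suc m) (λ k → toℕ k ℕ.<? m)
                              s≤s⁻¹ s≤s)
                  (count-below m≤n))

count-permute : {P : Pred (Fin n) 0ℓ} (P? : Decidable P) (π : Perm n) →
                count P? ≡ count (P? ∘ (π ⟨$⟩ʳ_))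
count-permute P? π = ∑-permute (λ k → χ (P? k)) π

length-filter-tabulate : ∀ {P : Pred A 0ℓ} (P? : Decidable P) (f : Fin n → A) →
                         length (filter P? (tabulate f)) ≡ count (P? ∘ f)
length-filter-tabulate {n = zero}  P? f = refl
length-filter-tabulate {n = suc n} P? f with P? (f Fin.zero)
... | yes _ = cong suc (length-filter-tabulate P? (f ∘ Fin.suc))
... | no _  = length-filter-tabulate P? (f ∘ Fin.suc)

DownwardClosed : Pred (Fin n) 0ℓ → Set
DownwardClosed P = ∀ {j k} → j < k → P k → P j

module _ {P : Pred (Fin n) 0ℓ} (P? : Decidable P) (closed : DownwardClosed P) where

  ∈⇒<count : ∀ {j} → P j → toℕ j ℕ.< count P?
  ∈⇒<count {j} Pj = ≤-trans (≤-reflexive (sym (count-below (toℕ<n j))))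
                           (count-mono (λ k → toℕ k ℕ.<? suc (toℕ j)) P? up-to-j⊆P)
    where
    up-to-j⊆P : ∀ {k} → toℕ k ℕ.< suc (toℕ j) → P k
    up-to-j⊆P k<1+j with m<1+n⇒m<n∨m≡n k<1+j
    ... | inj₁ k<j = closed k<j Pj
    ... | inj₂ k≡j = subst P (sym (toℕ-injective k≡j)) Pj

  <count⇒∈ : ∀ {j} → toℕ j ℕ.< count P? → P j
  <count⇒∈ {j} j<#P with P? j
  ... | yes Pj = Pj
  ... | no ¬Pj = contradiction (≤-trans (count-mono P? (λ k → toℕ k ℕ.<? toℕ j) P⊆below-j)
                                        (≤-reflexive (count-below (<⇒≤ (toℕ<n j)))))
                               (<⇒≱ j<#P)
    where
    P⊆below-j : ∀ {k} → P k → toℕ k ℕ.< toℕ j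
    P⊆below-j {k} Pk with <-cmp k j
    ... | tri< k<j _ _ = k<j
    ... | tri≈ _ k≡j _ = contradiction (subst P k≡j Pk) ¬Pj
    ... | tri> _ _ j<k = contradiction (closed j<k Pk) ¬Pj

AtLeastOn : ℕ → ℕ → (Fin n → ℕ) → Set
AtLeastOn a m f = ∀ k → a ≤ toℕ k → toℕ k ≤ m → a ≤ f k

IndexBounded : (Fin n → ℕ) → Set
IndexBounded g = ∀ k → g k ≤ toℕ k

Complementary : (Fin n → ℕ) → (Fin n → ℕ) → Set
Complementary ℓ r = ∀ i → ℓ i + r i ≡ toℕ i

module _ {ℓ r : Fin n → ℕ} (ℓ+r≡index : Complementary ℓ r) where

  Complementary-swap : Complementary r ℓ
  Complementary-swap i = trans (+-comm (r i) (ℓ i)) (ℓ+r≡index i)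

  Complementary⇒bounded : IndexBounded r
  Complementary⇒bounded i = subst (r i ≤_) (ℓ+r≡index i) (m≤n+m (r i) (ℓ i))

  ℓ≡0⇒r≡index : ∀ {i} → ℓ i ≡ 0 → r i ≡ toℕ i
  ℓ≡0⇒r≡index {i} ℓi≡0 = subst (λ x → x + r i ≡ toℕ i) ℓi≡0 (ℓ+r≡index i)

  r≡index⇒ℓ≡0 : ∀ {i} → r i ≡ toℕ i → ℓ i ≡ 0
  r≡index⇒ℓ≡0 {i} ri≡i = +-cancelʳ-≡ (r i) (ℓ i) 0 (trans (ℓ+r≡index i) (sym ri≡i))

Persistent : (Fin n → ℕ) → Set
Persistent ℓ = ∀ p → AtLeastOn (ℓ p) (toℕ p) ℓ

flip-compare : {_≺_ : Rel A 0ℓ} → Trichotomous _≡_ _≺_ → Trichotomous _≡_ (flip _≺_)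
flip-compare compare a b with compare a b
... | tri< a≺b a≢b b⊀a = tri> b⊀a a≢b a≺b
... | tri≈ a⊀b a≡b b⊀a = tri≈ b⊀a a≡b a⊀b
... | tri> a⊀b a≢b b≺a = tri< b≺a a≢b a⊀b

earlierCount : {_≺_ : Rel (Fin n) 0ℓ} → Decidable₂ _≺_ → Fin n → ℕ
earlierCount {n} _≺?_ i = length (filter (λ j → (j <? i) ×-dec (j ≺? i)) (allFin n))

Avoids312By : Rel (Fin n) 0ℓ → Set
Avoids312By _≺_ = ∀ i j k → i < j → j < k → j ≺ k → k ≺ i → ⊥

module EarlierCount {n : ℕ} {_≺_ : Rel (Fin n) 0ℓ} (_≺?_ : Decidable₂ _≺_)
                    (compare : Trichotomous _≡_ _≺_) (≺-trans : Transitive _≺_) where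

  LesserBefore : Fin n → Pred (Fin n) 0ℓ
  LesserBefore i j = j < i × j ≺ i

  lesserBefore? : ∀ i → Decidable (LesserBefore i)
  lesserBefore? i j = (j <? i) ×-dec (j ≺? i)

  earlierCount≡count : ∀ i → earlierCount _≺?_ i ≡ count (lesserBefore? i)
  earlierCount≡count i = length-filter-tabulate (lesserBefore? i) (λ j → j)

  earlierCount+flip≡index : Complementary (earlierCount _≺?_) (earlierCount (flip _≺?_))
  earlierCount+flip≡index i = begin
    earlierCount _≺?_ i + earlierCount (flip _≺?_) i
      ≡⟨ cong₂ _+_ (earlierCount≡count i) (length-filter-tabulate greaterBefore? (λ j → j)) ⟩
    count (lesserBefore? i) + count greaterBefore?
      ≡⟨ count-⊎ before? (lesserBefore? i) greaterBefore? split [ proj₁ , proj₁ ] disjoint ⟨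
    count before?
      ≡⟨ count-below (<⇒≤ (toℕ<n i)) ⟩
    toℕ i
      ∎
    where
    open ≡-Reasoning
    before? : Decidable (_< i)
    before? j = j <? i
    greaterBefore? : Decidable (λ j → j < i × i ≺ j)
    greaterBefore? j = (j <? i) ×-dec (i ≺? j)
    split : ∀ {j} → j < i → LesserBefore i j ⊎ (j < i × i ≺ j)
    split {j} j<i with compare j i
    ... | tri< j≺i _ _ = inj₁ (j<i , j≺i)
    ... | tri≈ _ j≡i _ = contradiction j≡i (<⇒≢ j<i)
    ... | tri> _ _ i≺j = inj₂ (j<i , i≺j)
    disjoint : ∀ {j} → LesserBefore i j → ¬ (j < i × i ≺ j)
    disjoint (_ , j≺i) (_ , i≺j) = tri⇒asym compare j≺i i≺j

  earlierCount≡0⇒left-to-right-min : ∀ {i} → earlierCount _≺?_ i ≡ 0 → ∀ j → j < i → i ≺ j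
  earlierCount≡0⇒left-to-right-min {i} none j j<i with compare j i
  ... | tri< j≺i _ _ = contradiction (j<i , j≺i)
                         (count≡0⇒∉ (lesserBefore? i) (trans (sym (earlierCount≡count i)) none) j)
  ... | tri≈ _ j≡i _ = contradiction j≡i (<⇒≢ j<i)
  ... | tri> _ _ i≺j = i≺j

  module _ (avoids : Avoids312By _≺_) where

    LesserBefore-closed : ∀ p → DownwardClosed (LesserBefore p)
    LesserBefore-closed p {j} {k} j<k (k<p , k≺p) with compare j p
    ... | tri< j≺p _ _ = <-trans j<k k<p , j≺p
    ... | tri≈ _ j≡p _ = contradiction j≡p (<⇒≢ (<-trans j<k k<p))
    ... | tri> _ _ p≺j = ⊥-elim (avoids j k p j<k k<p k≺p p≺j)

    persistent : Persistent (earlierCount _≺?_)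
    persistent p k ≺count≤k k≤p = begin
      earlierCount _≺?_ p      ≡⟨ earlierCount≡count p ⟩
      c                        ≡⟨ count-below c≤n ⟨
      count below-c?           ≤⟨ count-mono below-c? (lesserBefore? k) below-c⇒lesser ⟩
      count (lesserBefore? k)  ≡⟨ earlierCount≡count k ⟨
      earlierCount _≺?_ k      ∎
      where
      open ≤-Reasoning
      c : ℕ
      c = count (lesserBefore? p)
      below-c? : Decidable (λ j → toℕ j ℕ.< c)
      below-c? j = toℕ j ℕ.<? c
      c≤k : c ≤ toℕ k
      c≤k = subst (_≤ toℕ k) (earlierCount≡count p) ≺count≤k
      c≤n : c ≤ n
      c≤n = ≤-trans c≤k (<⇒≤ (toℕ<n k))
      p≺k : k < p → p ≺ k
      p≺k k<p with compare k p
      ... | tri< k≺p _ _ =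
        ⊥-elim (<⇒≱ (∈⇒<count (lesserBefore? p) (LesserBefore-closed p) (k<p , k≺p)) c≤k)
      ... | tri≈ _ k≡p _ = contradiction k≡p (<⇒≢ k<p)
      ... | tri> _ _ p≺k = p≺k
      below-c⇒lesser : ∀ {j} → toℕ j ℕ.< c → LesserBefore k j
      below-c⇒lesser {j} j<c = <-≤-trans j<c c≤k , j≺k (m≤n⇒m<n∨m≡n k≤p)
        where
        j≺p : j ≺ p
        j≺p = proj₂ (<count⇒∈ (lesserBefore? p) (LesserBefore-closed p) j<c)
        j≺k : k < p ⊎ toℕ k ≡ toℕ p → j ≺ k
        j≺k (inj₁ k<p) = ≺-trans j≺p (p≺k k<p)
        j≺k (inj₂ k≡p) = subst (j ≺_) (sym (toℕ-injective k≡p)) j≺p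

countAtLeast : (Fin n → ℕ) → ℕ → ℕ → ℕ
countAtLeast f m t = count (λ k → (toℕ k ℕ.<? m) ×-dec (t ℕ.≤? f k))

-- Equality of the multisets of values of f and g on the positions below m, encoded by
-- counting the values ≥ t for every threshold t.
SameMultiset : ℕ → (Fin n → ℕ) → (Fin n → ℕ) → Set
SameMultiset m f g = ∀ t → countAtLeast f m t ≡ countAtLeast g m t

module _ {f g : Fin n → ℕ} where

  rearrangement⇒SameMultiset : IsRearrangementOf f g → SameMultiset n f g
  rearrangement⇒SameMultiset (π , f≡g∘π) t = begin
    countAtLeast f n t                   ≡⟨ all-below f ⟩
    count (λ k → t ℕ.≤? f k)             ≡⟨ sum-cong-≗ (λ k → cong (λ x → χ (t ℕ.≤? x)) (f≡g∘π k)) ⟩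
    count (λ k → t ℕ.≤? g (π ⟨$⟩ʳ k))    ≡⟨ count-permute (λ k → t ℕ.≤? g k) π ⟨
    count (λ k → t ℕ.≤? g k)             ≡⟨ all-below g ⟨
    countAtLeast g n t                   ∎
    where
    open ≡-Reasoning
    all-below : ∀ h → countAtLeast h n t ≡ count (λ k → t ℕ.≤? h k)
    all-below h = count-cong _ (λ k → t ℕ.≤? h k) proj₂ (λ {k} → toℕ<n k ,_)

countAtLeast-suc : (f : Fin n → ℕ) {m : ℕ} {p : Fin n} → toℕ p ≡ m →
                   ∀ t → countAtLeast f (suc m) t ≡ countAtLeast f m t + χ (t ℕ.≤? f p)
countAtLeast-suc f {p = p} refl t = trans
  (count-⊎ _ _ at-p? split unsplit disjoint)
  (cong (countAtLeast f (toℕ p) t +_)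
        (trans (count-singleton at-p? (λ (k≡p , _) → toℕ-injective (sym k≡p)))
               (χ-cong proj₂ (refl ,_) (at-p? p) (t ℕ.≤? f p))))
  where
  at-p? : Decidable (λ k → toℕ k ≡ toℕ p × t ≤ f k)
  at-p? k = (toℕ k ℕ.≟ toℕ p) ×-dec (t ℕ.≤? f k)
  split : ∀ {k} → toℕ k ℕ.< suc (toℕ p) × t ≤ f k →
          (toℕ k ℕ.< toℕ p × t ≤ f k) ⊎ (toℕ k ≡ toℕ p × t ≤ f k)
  split (k<1+p , t≤fk) = Sum.map (_, t≤fk) (_, t≤fk) (m<1+n⇒m<n∨m≡n k<1+p)
  unsplit : ∀ {k} → (toℕ k ℕ.< toℕ p × t ≤ f k) ⊎ (toℕ k ≡ toℕ p × t ≤ f k) →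
            toℕ k ℕ.< suc (toℕ p) × t ≤ f k
  unsplit (inj₁ (k<p , t≤fk)) = m<n⇒m<1+n k<p , t≤fk
  unsplit (inj₂ (k≡p , t≤fk)) = ≤-reflexive (cong suc k≡p) , t≤fk
  disjoint : ∀ {k} → toℕ k ℕ.< toℕ p × t ≤ f k → ¬ (toℕ k ≡ toℕ p × t ≤ f k)
  disjoint (k<p , _) (k≡p , _) = <⇒≱ k<p (≤-reflexive (sym k≡p))

SameMultiset-shrink : {f g : Fin n → ℕ} {m : ℕ} {p : Fin n} → toℕ p ≡ m → f p ≡ g p →
                      SameMultiset (suc m) f g → SameMultiset m f g
SameMultiset-shrink {f = f} {g} {m} {p} p≡m fp≡gp same t = +-cancelʳ-≡ (χ (t ℕ.≤? f p)) _ _ (begin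
  countAtLeast f m t + χ (t ℕ.≤? f p)   ≡⟨ countAtLeast-suc f p≡m t ⟨
  countAtLeast f (suc m) t              ≡⟨ same t ⟩
  countAtLeast g (suc m) t              ≡⟨ countAtLeast-suc g p≡m t ⟩
  countAtLeast g m t + χ (t ℕ.≤? g p)   ≡⟨ cong (λ x → countAtLeast g m t + χ (t ℕ.≤? x)) fp≡gp ⟨
  countAtLeast g m t + χ (t ℕ.≤? f p)   ∎)
  where open ≡-Reasoning

-- On the positions ≤ m, f has a value ≥ a at each of the positions a, …, m, while g, being
-- bounded by the index, can reach a nowhere else; so the equal counts force g ≥ a there too.
AtLeastOn-transfer : {f g : Fin n → ℕ} {m a : ℕ} → IndexBounded g → SameMultiset (suc m) f g →
                     AtLeastOn a m f → AtLeastOn a m g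
AtLeastOn-transfer {f = f} {g} {m} {a} g≤index same f≥a k a≤k k≤m =
  proj₂ (count-squeeze between? g≥a? g≥a⇒between #between≤#g≥a (a≤k , k≤m))
  where
  between? : Decidable (λ k → a ≤ toℕ k × toℕ k ≤ m)
  between? k = (a ℕ.≤? toℕ k) ×-dec (toℕ k ℕ.≤? m)
  f≥a? g≥a? : Decidable _
  f≥a? k = (toℕ k ℕ.<? suc m) ×-dec (a ℕ.≤? f k)
  g≥a? k = (toℕ k ℕ.<? suc m) ×-dec (a ℕ.≤? g k)
  g≥a⇒between : ∀ {k} → toℕ k ℕ.< suc m × a ≤ g k → a ≤ toℕ k × toℕ k ≤ m
  g≥a⇒between {k} (k<1+m , a≤gk) = ≤-trans a≤gk (g≤index k) , s≤s⁻¹ k<1+m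
  #between≤#g≥a : count between? ≤ count g≥a?
  #between≤#g≥a = ≤-trans (count-mono between? f≥a? (λ {k} (a≤k , k≤m) → s≤s k≤m , f≥a k a≤k k≤m))
                          (≤-reflexive (same a))

m+n≤n⇒m≡0 : ∀ {m n} → m + n ≤ n → m ≡ 0
m+n≤n⇒m≡0 {m} {n} m+n≤n = n≤0⇒n≡0 (+-cancelʳ-≤ n m 0 m+n≤n)

index-value-transfer : {f g : Fin n → ℕ} (p : Fin n) → IndexBounded g →
                       SameMultiset (suc (toℕ p)) f g → f p ≡ toℕ p → g p ≡ toℕ p
index-value-transfer {f = f} p g≤index same fp≡p =
  ≤-antisym (g≤index p) (AtLeastOn-transfer g≤index same f≥p-at-p p ≤-refl ≤-refl)
  where
  f≥p-at-p : AtLeastOn (toℕ p) (toℕ p) f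
  f≥p-at-p k p≤k k≤p = subst (λ k → toℕ p ≤ f k) (toℕ-injective (≤-antisym p≤k k≤p))
                             (≤-reflexive (sym fp≡p))

zero-at-top : {ℓ₁ r₁ ℓ₂ r₂ : Fin n → ℕ} → Complementary ℓ₁ r₁ → Complementary ℓ₂ r₂ →
              Persistent ℓ₁ → Persistent r₂ → ∀ {m} p → toℕ p ≡ m →
              SameMultiset (suc m) r₁ r₂ → ℓ₁ p ≤ r₂ p → ℓ₁ p ≡ 0 × ℓ₂ p ≡ 0
zero-at-top {n = n} {ℓ₁ = ℓ₁} {r₁} {ℓ₂} {r₂} ℓ₁+r₁≡index ℓ₂+r₂≡index persistent₁ persistent₂
            p refl same ℓ₁p≤r₂p = ℓ₁p≡0 , ℓ₂p≡0
  where
  r₂p≤p : r₂ p ≤ toℕ p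
  r₂p≤p = Complementary⇒bounded {ℓ = ℓ₂} ℓ₂+r₂≡index p
  K : Fin n
  K = fromℕ< (≤-<-trans r₂p≤p (toℕ<n p))
  K≡r₂p : toℕ K ≡ r₂ p
  K≡r₂p = toℕ-fromℕ< _
  K≤p : toℕ K ≤ toℕ p
  K≤p = ≤-trans (≤-reflexive K≡r₂p) r₂p≤p
  r₂p≤r₁K : r₂ p ≤ r₁ K
  r₂p≤r₁K = AtLeastOn-transfer (Complementary⇒bounded {ℓ = ℓ₁} ℓ₁+r₁≡index) (sym ∘ same)
                               (persistent₂ p) K (≤-reflexive (sym K≡r₂p)) K≤p
  ℓ₁p≤ℓ₁K : ℓ₁ p ≤ ℓ₁ K
  ℓ₁p≤ℓ₁K = persistent₁ p K (≤-trans ℓ₁p≤r₂p (≤-reflexive (sym K≡r₂p))) K≤p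
  ℓ₁p≡0 : ℓ₁ p ≡ 0
  ℓ₁p≡0 = m+n≤n⇒m≡0 (begin
    ℓ₁ p + r₂ p  ≤⟨ +-mono-≤ ℓ₁p≤ℓ₁K r₂p≤r₁K ⟩
    ℓ₁ K + r₁ K  ≡⟨ ℓ₁+r₁≡index K ⟩
    toℕ K        ≡⟨ K≡r₂p ⟩
    r₂ p         ∎)
    where open ≤-Reasoning
  ℓ₂p≡0 : ℓ₂ p ≡ 0
  ℓ₂p≡0 = r≡index⇒ℓ≡0 {ℓ = ℓ₂} ℓ₂+r₂≡index
            (index-value-transfer p (Complementary⇒bounded {ℓ = ℓ₂} ℓ₂+r₂≡index) same
              (ℓ≡0⇒r≡index {ℓ = ℓ₁} ℓ₁+r₁≡index ℓ₁p≡0))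

JointRecord : (ℓ₁ r₁ ℓ₂ r₂ : Fin n → ℕ) → Fin n → Set
JointRecord ℓ₁ r₁ ℓ₂ r₂ p = (ℓ₁ p ≡ 0 × ℓ₂ p ≡ 0) ⊎ (r₁ p ≡ 0 × r₂ p ≡ 0)

module _ {n : ℕ} {ℓ₁ r₁ ℓ₂ r₂ : Fin n → ℕ}
         (ℓ₁+r₁≡index : Complementary ℓ₁ r₁) (ℓ₂+r₂≡index : Complementary ℓ₂ r₂)
         (persistent₁ : Persistent ℓ₁) (persistent₂ : Persistent r₂) where

  private
    r₁+ℓ₁≡index : Complementary r₁ ℓ₁
    r₁+ℓ₁≡index = Complementary-swap {ℓ = ℓ₁} ℓ₁+r₁≡index
    r₂+ℓ₂≡index : Complementary r₂ ℓ₂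
    r₂+ℓ₂≡index = Complementary-swap {ℓ = ℓ₂} ℓ₂+r₂≡index

  JointRecord-at-top : ∀ {m} p → toℕ p ≡ m →
                       SameMultiset (suc m) ℓ₁ ℓ₂ → SameMultiset (suc m) r₁ r₂ →
                       JointRecord ℓ₁ r₁ ℓ₂ r₂ p
  JointRecord-at-top p p≡m sameˡ sameʳ with ≤-total (ℓ₁ p) (r₂ p)
  ... | inj₁ ℓ₁p≤r₂p = inj₁ (zero-at-top ℓ₁+r₁≡index ℓ₂+r₂≡index persistent₁ persistent₂
                                         p p≡m sameʳ ℓ₁p≤r₂p)
  ... | inj₂ r₂p≤ℓ₁p = inj₂ (swap (zero-at-top r₂+ℓ₂≡index r₁+ℓ₁≡index persistent₂ persistent₁
                                               p p≡m (sym ∘ sameˡ) r₂p≤ℓ₁p))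

  JointRecord⇒agree : ∀ {p} → JointRecord ℓ₁ r₁ ℓ₂ r₂ p → ℓ₁ p ≡ ℓ₂ p × r₁ p ≡ r₂ p
  JointRecord⇒agree (inj₁ (ℓ₁p≡0 , ℓ₂p≡0)) =
    trans ℓ₁p≡0 (sym ℓ₂p≡0) ,
    trans (ℓ≡0⇒r≡index {ℓ = ℓ₁} ℓ₁+r₁≡index ℓ₁p≡0) (sym (ℓ≡0⇒r≡index {ℓ = ℓ₂} ℓ₂+r₂≡index ℓ₂p≡0))
  JointRecord⇒agree (inj₂ (r₁p≡0 , r₂p≡0)) =
    trans (ℓ≡0⇒r≡index {ℓ = r₁} r₁+ℓ₁≡index r₁p≡0) (sym (ℓ≡0⇒r≡index {ℓ = r₂} r₂+ℓ₂≡index r₂p≡0)) ,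
    trans r₁p≡0 (sym r₂p≡0)

  JointRecords-below : ∀ m → m ≤ n → SameMultiset m ℓ₁ ℓ₂ → SameMultiset m r₁ r₂ →
                       ∀ p → toℕ p ℕ.< m → JointRecord ℓ₁ r₁ ℓ₂ r₂ p
  JointRecords-below (suc m) m<n sameˡ sameʳ p p<1+m with m<1+n⇒m<n∨m≡n p<1+m
  ... | inj₂ p≡m = JointRecord-at-top p p≡m sameˡ sameʳ
  ... | inj₁ p<m = JointRecords-below m (<⇒≤ m<n)
                     (SameMultiset-shrink last≡m (proj₁ agree) sameˡ)
                     (SameMultiset-shrink last≡m (proj₂ agree) sameʳ) p p<m
    where
    last : Fin n
    last = fromℕ< m<n
    last≡m : toℕ last ≡ m
    last≡m = toℕ-fromℕ< m<n
    agree : ℓ₁ last ≡ ℓ₂ last × r₁ last ≡ r₂ last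
    agree = JointRecord⇒agree (JointRecord-at-top last last≡m sameˡ sameʳ)

  JointRecords : SameMultiset n ℓ₁ ℓ₂ → SameMultiset n r₁ r₂ → ∀ p → JointRecord ℓ₁ r₁ ℓ₂ r₂ p
  JointRecords sameˡ sameʳ p = JointRecords-below n ≤-refl sameˡ sameʳ p (toℕ<n p)

module _ {n : ℕ} (w : Perm n) where

  private
    W : Fin n → Fin n
    W = w ⟨$⟩ʳ_

    W-injective : ∀ {a b} → W a ≡ W b → a ≡ b
    W-injective Wa≡Wb = trans (sym (inverseˡ w)) (trans (cong (w ⟨$⟩ˡ_) Wa≡Wb) (inverseˡ w))

    compareᵂ : Trichotomous _≡_ (λ a b → W a < W b)
    compareᵂ a b with <-cmp (W a) (W b)
    ... | tri< Wa<Wb Wa≢Wb Wb≮Wa = tri< Wa<Wb (Wa≢Wb ∘ cong W) Wb≮Wa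
    ... | tri≈ Wa≮Wb Wa≡Wb Wb≮Wa = tri≈ Wa≮Wb (W-injective Wa≡Wb) Wb≮Wa
    ... | tri> Wa≮Wb Wa≢Wb Wb<Wa = tri> Wa≮Wb (Wa≢Wb ∘ cong W) Wb<Wa

    module Ascending  = EarlierCount (λ a b → W a <? W b) compareᵂ <-trans
    module Descending = EarlierCount (λ a b → W b <? W a) (flip-compare compareᵂ)
                                     (λ Wb<Wa Wc<Wb → <-trans Wc<Wb Wb<Wa)

  l+r≡index : Complementary (l w) (r w)
  l+r≡index = Ascending.earlierCount+flip≡index

  l≡0⇒left-to-right-min : ∀ {i} → l w i ≡ 0 → ∀ j → j < i → w ⟨$⟩ʳ i < w ⟨$⟩ʳ j
  l≡0⇒left-to-right-min = Ascending.earlierCount≡0⇒left-to-right-min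

  r≡0⇒left-to-right-max : ∀ {i} → r w i ≡ 0 → ∀ j → j < i → w ⟨$⟩ʳ j < w ⟨$⟩ʳ i
  r≡0⇒left-to-right-max = Descending.earlierCount≡0⇒left-to-right-min

  avoids312⇒l-persistent : Avoids312 w → Persistent (l w)
  avoids312⇒l-persistent = Ascending.persistent

  avoids132⇒r-persistent : Avoids132 w → Persistent (r w)
  avoids132⇒r-persistent avoids =
    Descending.persistent (λ i j k i<j j<k Wk<Wj Wi<Wk → avoids i j k i<j j<k Wi<Wk Wk<Wj)

  count-smaller≡value : ∀ i → count (λ j → w ⟨$⟩ʳ j <? w ⟨$⟩ʳ i) ≡ toℕ (w ⟨$⟩ʳ i)
  count-smaller≡value i =
    trans (sym (count-permute (_<? W i) w)) (count-below (<⇒≤ (toℕ<n (W i))))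

module _ {n : ℕ} (w u : Perm n) where

  same-order : (∀ p → JointRecord (l w) (r w) (l u) (r u) p) →
               ∀ i j → w ⟨$⟩ʳ j < w ⟨$⟩ʳ i → u ⟨$⟩ʳ j < u ⟨$⟩ʳ i
  same-order records i j wj<wi with <-cmp j i
  ... | tri< j<i _ _ with records i
  ...   | inj₁ (lwi≡0 , _) = contradiction (l≡0⇒left-to-right-min w lwi≡0 j j<i) (<-asym wj<wi)
  ...   | inj₂ (_ , rui≡0) = r≡0⇒left-to-right-max u rui≡0 j j<i
  same-order records i j wj<wi | tri≈ _ j≡i _ = contradiction (cong (w ⟨$⟩ʳ_) j≡i) (<⇒≢ wj<wi)
  same-order records i j wj<wi | tri> _ _ i<j with records j
  ...   | inj₁ (_ , luj≡0) = l≡0⇒left-to-right-min u luj≡0 i i<j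
  ...   | inj₂ (rwj≡0 , _) = contradiction (r≡0⇒left-to-right-max w rwj≡0 i i<j) (<-asym wj<wi)

  same-order⇒≡ : ∀ i → (∀ j → w ⟨$⟩ʳ j < w ⟨$⟩ʳ i → u ⟨$⟩ʳ j < u ⟨$⟩ʳ i) →
                 (∀ j → u ⟨$⟩ʳ j < u ⟨$⟩ʳ i → w ⟨$⟩ʳ j < w ⟨$⟩ʳ i) → w ⟨$⟩ʳ i ≡ u ⟨$⟩ʳ i
  same-order⇒≡ i w⇒u u⇒w = toℕ-injective (begin
    toℕ (w ⟨$⟩ʳ i)            ≡⟨ count-smaller≡value w i ⟨
    count smaller-in-w?       ≡⟨ count-cong smaller-in-w? smaller-in-u? (w⇒u _) (u⇒w _) ⟩
    count smaller-in-u?       ≡⟨ count-smaller≡value u i ⟩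
    toℕ (u ⟨$⟩ʳ i)            ∎)
    where
    open ≡-Reasoning
    smaller-in-w? : Decidable (λ j → w ⟨$⟩ʳ j < w ⟨$⟩ʳ i)
    smaller-in-w? j = w ⟨$⟩ʳ j <? w ⟨$⟩ʳ i
    smaller-in-u? : Decidable (λ j → u ⟨$⟩ʳ j < u ⟨$⟩ʳ i)
    smaller-in-u? j = u ⟨$⟩ʳ j <? u ⟨$⟩ʳ i

proposition2p3 : (n : ℕ) (w u : Perm n) → Avoids312 w → Avoids132 u →
    IsRearrangementOf (L w) (L u) → IsRearrangementOf (R w) (R u) →
    (i : Fin n) → w ⟨$⟩ʳ i ≡ u ⟨$⟩ʳ i
proposition2p3 n w u avoids312 avoids132 L-rearranged R-rearranged i =
  same-order⇒≡ w u i (same-order w u records i) (same-order u w (Sum.map swap swap ∘ records) i)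
  where
  records : ∀ p → JointRecord (l w) (r w) (l u) (r u) p
  records = JointRecords (l+r≡index w) (l+r≡index u)
              (avoids312⇒l-persistent w avoids312) (avoids132⇒r-persistent u avoids132)
              (rearrangement⇒SameMultiset L-rearranged) (rearrangement⇒SameMultiset R-rearranged)
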